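{- For a hereditary graph property $\Phi$ the following are equivalent: (1) $\Phi$ is not meagre; (2) $\Phi$ is true for infinitely many graphs and $\Pi(\Phi)\neq\emptyset$; (3) $\Phi$ is not constant true, and there are no positive integers $s,t$ such that $\Phi(K_s)=\Phi(I_t)=0$.
   Context: Graph properties are isomorphism-invariant functions from finite simple graphs to $\{0,1\}$. $\Phi$ is hereditary if it is closed under taking induced subgraphs; $\Pi(\Phi)$ denotes its set of (inclusion-minimal) forbidden induced subgraphs, so that $\Phi(H)=1$ iff no induced subgraph of $H$ is in $\Pi(\Phi)$. $\Phi$ is meagre if there are only finitely many $k$ for which $\Phi$ is not constant on the set of all $k$-vertex graphs. $K_s$ is the complete graph and $I_t$ the edgeless graph on $t$ vertices. -}

module Defs where

open import Data.Nat using (ℕ; _≤_; _<_)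
open import Data.Bool using (Bool; true; false)
open import Data.Fin using (Fin; _≟_)
open import Data.List using (List)
open import Data.List.Relation.Unary.Any using (Any)
open import Data.Product using (Σ; ∃; ∃-syntax; _×_; _,_; proj₁; proj₂)
open import Data.Empty using (⊥-elim)
open import Relation.Nullary using (¬_; yes; no; does)
open import Relation.Binary.PropositionalEquality using (_≡_; refl; sym)
open import Function.Bundles using (_↔_; Inverse)
open import Function.Definitions using (Injective)

record Graph (n : ℕ) : Set where
  field
    adj    : Fin n → Fin n → Bool
    adj-sym : ∀ i j → adj i j ≡ adj j i
    irrefl : ∀ i → adj i i ≡ false

open Graph public

AnyGraph : Set
AnyGraph = Σ ℕ Graph

record _≅_ {m n : ℕ} (G : Graph m) (H : Graph n) : Set where
  field
    bij      : Fin m ↔ Fin n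
    preserve : ∀ i j → adj G i j ≡ adj H (Inverse.to bij i) (Inverse.to bij j)

record _↪_ {m n : ℕ} (H : Graph m) (G : Graph n) : Set where
  field
    emb      : Fin m → Fin n
    emb-inj  : Injective _≡_ _≡_ emb
    preserve : ∀ i j → adj H i j ≡ adj G (emb i) (emb j)

-- Graph properties: functions from finite simple graphs to {0,1} = Bool

GraphFun : Set
GraphFun = ∀ {n} → Graph n → Bool

IsoInvariant : GraphFun → Set
IsoInvariant Φ = ∀ {m n} (G : Graph m) (H : Graph n) → G ≅ H → Φ G ≡ Φ H

Hereditary : GraphFun → Set
Hereditary Φ = ∀ {m n} (H : Graph m) (G : Graph n) → H ↪ G → Φ G ≡ true → Φ H ≡ true

-- H ∈ Π(Φ): H is a forbidden induced subgraph (Φ H = 0) that is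
-- inclusion-minimal: every proper induced subgraph (fewer vertices) has Φ = 1
InΠ : GraphFun → ∀ {n} → Graph n → Set
InΠ Φ {n} H = (Φ H ≡ false) × (∀ {m} (H' : Graph m) → H' ↪ H → m < n → Φ H' ≡ true)

ΠEmpty : GraphFun → Set
ΠEmpty Φ = ∀ {n} (H : Graph n) → ¬ InΠ Φ H

ConstantOn : GraphFun → ℕ → Set
ConstantOn Φ k = ∀ (G H : Graph k) → Φ G ≡ Φ H

-- meagre: only finitely many k for which Φ is not constant on k-vertex graphs,
-- i.e. there is a bound N beyond which Φ is constant on each level
Meagre : GraphFun → Set
Meagre Φ = ∃[ N ] (∀ k → N ≤ k → ConstantOn Φ k)

TrueForFinitelyMany : GraphFun → Set
TrueForFinitelyMany Φ =
  Σ (List AnyGraph) λ L → (∀ {n} (G : Graph n) → Φ G ≡ true →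
            Any (λ (P : AnyGraph) → G ≅ proj₂ P) L)

TrueForInfinitelyMany : GraphFun → Set
TrueForInfinitelyMany Φ = ¬ TrueForFinitelyMany Φ

ConstantTrue : GraphFun → Set
ConstantTrue Φ = ∀ {n} (G : Graph n) → Φ G ≡ true

complete : (s : ℕ) → Graph s
adj (complete s) i j with i ≟ j
... | yes _ = false
... | no _ = true
adj-sym (complete s) i j with i ≟ j | j ≟ i
... | yes _ | yes _ = refl
... | no _  | no _  = refl
... | yes p | no q  = ⊥-elim (q (sym p))
... | no p  | yes q = ⊥-elim (p (sym q))
irrefl (complete s) i with i ≟ i
... | yes _ = refl
... | no p = ⊥-elim (p refl)

edgeless : (t : ℕ) → Graph t
adj (edgeless t) _ _ = false
adj-sym (edgeless t) _ _ = refl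
irrefl (edgeless t) _ = refl

-- If Φ(K_s) = Φ(I_t) = 0, then by Ramsey's theorem every graph on at least R(s,t)
-- vertices contains K_s or I_t as an induced subgraph, so Φ vanishes from R(s,t) on:
-- Φ is meagre and true for only finitely many graphs. Conversely, if Φ is true for
-- only finitely many graphs then Φ(K_k) = Φ(I_k) = 0 for large k; and if Φ is meagre
-- with threshold N and Φ(G) = 0 for some G, then padding G with isolated vertices
-- gives a false graph on each large order k, so constancy forces Φ(K_k) = Φ(I_k) = 0.
-- Finally Π(Φ) = ∅ exactly when Φ is constant true, since a false graph with the least
-- number of vertices is a minimal forbidden subgraph.
module Submission where

open import Defs
open import Data.Nat using (ℕ; zero; suc; _+_; _≤_; _<_; _≤?_; z≤n; s≤s)
open import Data.Nat.Properties
  using (≤-refl; ≤-trans; ≤-reflexive; ≰⇒>; <-≤-trans; +-mono-<; <-irrefl; +-suc;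
         m≤m+n; m≤n+m; n≤1+n; ≤∧≢⇒<; 1+n≰n)
import Data.Nat.Properties as ℕ
open import Data.Nat.ListAction using (sum)
open import Data.Bool using (Bool; true; false; _∧_)
open import Data.Bool.Properties using (¬-not; not-¬; ∧-comm; ∧-idem)
import Data.Bool.Properties as Bool
open import Data.Fin using (Fin; _≟_)
import Data.Fin as Fin
open import Data.Fin.Properties using (suc-injective; injective⇒≤)
open import Data.Vec using (Vec; lookup; tabulate)
import Data.Vec as Vec
open import Data.Vec.Properties using (lookup∘tabulate)
import Data.Vec.Functional as Vector
open import Data.List
  using (List; []; _∷_; length; map; filter; cartesianProductWith; _++_)
open import Data.List.Properties using (length-tabulate)
open import Data.List.Relation.Unary.Any using (Any; here; there)
import Data.List.Relation.Unary.Any as Any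
open import Data.List.Relation.Unary.Any.Properties using (map⁺; ++⁺ˡ; ++⁺ʳ)
open import Data.List.Relation.Unary.All.Properties using (All¬⇒¬Any)
open import Data.List.Relation.Unary.AllPairs using (_∷_)
open import Data.List.Relation.Unary.Unique.Propositional using (Unique)
open import Data.List.Relation.Unary.Unique.Propositional.Properties using (allFin⁺)
import Data.List.Relation.Unary.Unique.Propositional.Properties as Unique
open import Data.List.Membership.Propositional using (_∈_; _∉_)
open import Data.List.Membership.Propositional.Properties
  using (∈-filter⁻; ∈-cartesianProductWith⁺)
open import Data.List.Relation.Binary.Subset.Propositional using (_⊆_)
open import Data.List.Relation.Binary.Subset.Propositional.Properties using (filter-⊆)
open import Data.Product using (∃-syntax; _×_; _,_; proj₁; proj₂)
open import Data.Sum using (_⊎_; inj₁; inj₂)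
import Data.Sum as Sum
open import Data.Empty using (⊥-elim)
open import Function using (_∘_)
open import Function.Bundles using (_⇔_; mk⇔; Injection)
open import Function.Definitions using (Injective)
open import Function.Properties.Inverse using (↔-refl; ↔⇒↣)
open import Relation.Nullary using (¬_; yes; no; does)
open import Relation.Unary using (Pred; Decidable)
open import Relation.Unary.Properties using (∁?)
open import Relation.Binary.PropositionalEquality
  using (_≡_; _≢_; refl; sym; trans; cong; cong₂; module ≡-Reasoning)
open ≡-Reasoning

≤-+-split : ∀ a b x y → a + b ≤ x + y → a ≤ x ⊎ b ≤ y
≤-+-split a b x y a+b≤x+y with a ≤? x | b ≤? y
... | yes a≤x | _       = inj₁ a≤x
... | no _    | yes b≤y = inj₂ b≤y
... | no a≰x  | no b≰y  =
  ⊥-elim (<-irrefl refl (<-≤-trans (+-mono-< (≰⇒> a≰x) (≰⇒> b≰y)) a+b≤x+y))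

length-filter-∁ : ∀ {a p} {A : Set a} {P : Pred A p} (P? : Decidable P) xs →
                  length (filter P? xs) + length (filter (∁? P?) xs) ≡ length xs
length-filter-∁ P? [] = refl
length-filter-∁ P? (x ∷ xs) with does (P? x)
... | true  = cong suc (length-filter-∁ P? xs)
... | false = trans (+-suc _ _) (cong suc (length-filter-∁ P? xs))

↪-refl : ∀ {n} {G : Graph n} → G ↪ G
↪-refl = record { emb = λ i → i ; emb-inj = λ eq → eq ; preserve = λ _ _ → refl }

↪-trans : ∀ {k m n} {F : Graph k} {G : Graph m} {H : Graph n} → F ↪ G → G ↪ H → F ↪ H
↪-trans e f = record
  { emb      = f.emb ∘ e.emb
  ; emb-inj  = λ eq → e.emb-inj (f.emb-inj eq)
  ; preserve = λ i j → trans (e.preserve i j) (f.preserve (e.emb i) (e.emb j))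
  }
  where module e = _↪_ e; module f = _↪_ f

≅⇒≤ : ∀ {m n} {G : Graph m} {H : Graph n} → G ≅ H → m ≤ n
≅⇒≤ G≅H = injective⇒≤ (Injection.injective (↔⇒↣ (_≅_.bij G≅H)))

hereditary-false : ∀ {Φ : GraphFun} → Hereditary Φ →
                   ∀ {m n} {H : Graph m} {G : Graph n} → H ↪ G → Φ H ≡ false → Φ G ≡ false
hereditary-false her H↪G ΦH≡false = ¬-not λ ΦG≡true → not-¬ (her _ _ H↪G ΦG≡true) ΦH≡false

addIsolatedVertex : ∀ {n} → Graph n → Graph (suc n)
adj (addIsolatedVertex G) Fin.zero    _           = false
adj (addIsolatedVertex G) (Fin.suc i) Fin.zero    = false
adj (addIsolatedVertex G) (Fin.suc i) (Fin.suc j) = adj G i j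
adj-sym (addIsolatedVertex G) Fin.zero    Fin.zero    = refl
adj-sym (addIsolatedVertex G) Fin.zero    (Fin.suc j) = refl
adj-sym (addIsolatedVertex G) (Fin.suc i) Fin.zero    = refl
adj-sym (addIsolatedVertex G) (Fin.suc i) (Fin.suc j) = adj-sym G i j
irrefl (addIsolatedVertex G) Fin.zero    = refl
irrefl (addIsolatedVertex G) (Fin.suc i) = irrefl G i

↪-addIsolatedVertex : ∀ {n} (G : Graph n) → G ↪ addIsolatedVertex G
↪-addIsolatedVertex G = record { emb = Fin.suc ; emb-inj = suc-injective ; preserve = λ _ _ → refl }

addIsolatedVertices : ∀ {n} d → Graph n → Graph (d + n)
addIsolatedVertices zero    G = G
addIsolatedVertices (suc d) G = addIsolatedVertex (addIsolatedVertices d G)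

↪-addIsolatedVertices : ∀ {n} d (G : Graph n) → G ↪ addIsolatedVertices d G
↪-addIsolatedVertices zero    G = ↪-refl
↪-addIsolatedVertices (suc d) G =
  ↪-trans (↪-addIsolatedVertices d G) (↪-addIsolatedVertex (addIsolatedVertices d G))

ramseyBound : ℕ → ℕ → ℕ
ramseyBound zero    t       = 0
ramseyBound (suc s) zero    = 0
ramseyBound (suc s) (suc t) = suc (ramseyBound s (suc t) + ramseyBound (suc s) t)

uniform : Bool → (k : ℕ) → Graph k
uniform true  = complete
uniform false = edgeless

uniform-adj : ∀ b {k} {i j : Fin k} → i ≢ j → adj (uniform b k) i j ≡ b
uniform-adj false _ = refl
uniform-adj true {i = i} {j} i≢j with i ≟ j
... | yes i≡j = ⊥-elim (i≢j i≡j)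
... | no _    = refl

module Ramsey {n : ℕ} (G : Graph n) where

  record Homogeneous (b : Bool) (k : ℕ) (xs : List (Fin n)) : Set where
    field
      vertex    : Fin k → Fin n
      injective : Injective _≡_ _≡_ vertex
      coloured  : ∀ i j → i ≢ j → adj G (vertex i) (vertex j) ≡ b
      within    : ∀ i → vertex i ∈ xs

  open Homogeneous

  homogeneous-zero : ∀ {b xs} → Homogeneous b 0 xs
  homogeneous-zero = record { vertex = λ () ; injective = λ { {()} } ; coloured = λ () ; within = λ () }

  homogeneous-⊆ : ∀ {b k xs ys} → xs ⊆ ys → Homogeneous b k xs → Homogeneous b k ys
  homogeneous-⊆ xs⊆ys H = record
    { vertex = vertex H ; injective = injective H ; coloured = coloured H ; within = xs⊆ys ∘ within H }

  homogeneous-∷ : ∀ {b k v ys us} → v ∉ us → ys ⊆ us → (∀ {u} → u ∈ ys → adj G v u ≡ b) →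
                  Homogeneous b k ys → Homogeneous b (suc k) (v ∷ us)
  homogeneous-∷ {b} {k} {v} {us = us} v∉us ys⊆us v-b H = record
    { vertex = e ; injective = e-injective ; coloured = e-coloured ; within = e-within }
    where
      e : Fin (suc k) → Fin n
      e = v Vector.∷ vertex H

      e-within : ∀ i → e i ∈ v ∷ us
      e-within Fin.zero    = here refl
      e-within (Fin.suc i) = there (ys⊆us (within H i))

      v∉ys : ∀ i → v ≢ vertex H i
      v∉ys i refl = v∉us (ys⊆us (within H i))

      e-injective : Injective _≡_ _≡_ e
      e-injective {Fin.zero}  {Fin.zero}  _  = refl
      e-injective {Fin.zero}  {Fin.suc j} eq = ⊥-elim (v∉ys j eq)
      e-injective {Fin.suc i} {Fin.zero}  eq = ⊥-elim (v∉ys i (sym eq))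
      e-injective {Fin.suc i} {Fin.suc j} eq = cong Fin.suc (injective H eq)

      e-coloured : ∀ i j → i ≢ j → adj G (e i) (e j) ≡ b
      e-coloured Fin.zero    Fin.zero    i≢j = ⊥-elim (i≢j refl)
      e-coloured Fin.zero    (Fin.suc j) _   = v-b (within H j)
      e-coloured (Fin.suc i) Fin.zero    _   = trans (adj-sym G _ _) (v-b (within H i))
      e-coloured (Fin.suc i) (Fin.suc j) i≢j = coloured H i j (i≢j ∘ cong Fin.suc)

  homogeneous⇒↪ : ∀ {b k xs} → Homogeneous b k xs → uniform b k ↪ G
  homogeneous⇒↪ {b} {k} H = record { emb = vertex H ; emb-inj = injective H ; preserve = preserve }
    where
      preserve : ∀ i j → adj (uniform b k) i j ≡ adj G (vertex H i) (vertex H j)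
      preserve i j with i ≟ j
      ... | yes refl = trans (irrefl (uniform b k) i) (sym (irrefl G (vertex H i)))
      ... | no i≢j   = trans (uniform-adj b i≢j) (sym (coloured H i j i≢j))

  adjacent? : (v : Fin n) → Decidable (λ u → adj G v u ≡ true)
  adjacent? v u = adj G v u Bool.≟ true

  filter-adjacent : ∀ v us {u} → u ∈ filter (adjacent? v) us → adj G v u ≡ true
  filter-adjacent v us = proj₂ ∘ ∈-filter⁻ (adjacent? v) {xs = us}

  filter-nonadjacent : ∀ v us {u} → u ∈ filter (∁? (adjacent? v)) us → adj G v u ≡ false
  filter-nonadjacent v us = ¬-not ∘ proj₂ ∘ ∈-filter⁻ (∁? (adjacent? v)) {xs = us}

  -- The vertices after v split into its neighbours and its non-neighbours, and by the
  -- recursion for ramseyBound one side is large enough to apply induction to.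
  ramsey : ∀ s t {xs} → Unique xs → ramseyBound s t ≤ length xs →
           Homogeneous true s xs ⊎ Homogeneous false t xs
  ramsey zero    t       _ _ = inj₁ homogeneous-zero
  ramsey (suc s) zero    _ _ = inj₂ homogeneous-zero
  ramsey (suc s) (suc t) {v ∷ us} (v≢us ∷ unique) (s≤s bound)
    with ≤-+-split _ _ _ _ (≤-trans bound (≤-reflexive (sym (length-filter-∁ (adjacent? v) us))))
  ... | inj₁ big = Sum.[ inj₁ ∘ homogeneous-∷ (All¬⇒¬Any v≢us) (filter-⊆ _ us) (filter-adjacent v us)
                       , inj₂ ∘ homogeneous-⊆ (there ∘ filter-⊆ _ us) ]
                       (ramsey s (suc t) (Unique.filter⁺ _ unique) big)
  ... | inj₂ big = Sum.[ inj₁ ∘ homogeneous-⊆ (there ∘ filter-⊆ _ us)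
                       , inj₂ ∘ homogeneous-∷ (All¬⇒¬Any v≢us) (filter-⊆ _ us) (filter-nonadjacent v us) ]
                       (ramsey (suc s) t (Unique.filter⁺ _ unique) big)

  ramsey-↪ : ∀ s t → ramseyBound s t ≤ n → (complete s ↪ G) ⊎ (edgeless t ↪ G)
  ramsey-↪ s t bound =
    Sum.map homogeneous⇒↪ homogeneous⇒↪
      (ramsey s t (allFin⁺ n) (≤-trans bound (≤-reflexive (sym (length-tabulate (λ i → i))))))

vectors : ∀ {A : Set} → List A → (k : ℕ) → List (Vec A k)
vectors xs zero    = Vec.[] ∷ []
vectors xs (suc k) = cartesianProductWith Vec._∷_ xs (vectors xs k)

∈-vectors : ∀ {A : Set} {xs : List A} → (∀ x → x ∈ xs) → ∀ {k} (v : Vec A k) → v ∈ vectors xs k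
∈-vectors ∈xs Vec.[]       = here refl
∈-vectors ∈xs (x Vec.∷ v) = ∈-cartesianProductWith⁺ Vec._∷_ (∈xs x) (∈-vectors ∈xs v)

∈-bools : ∀ b → b ∈ true ∷ false ∷ []
∈-bools true  = here refl
∈-bools false = there (here refl)

graphFrom : ∀ {n} → (Fin n → Fin n → Bool) → Graph n
adj (graphFrom f) i j with i ≟ j
... | yes _ = false
... | no _  = f i j ∧ f j i
adj-sym (graphFrom f) i j with i ≟ j | j ≟ i
... | yes _    | yes _    = refl
... | no _     | no _     = ∧-comm (f i j) (f j i)
... | yes i≡j  | no j≢i   = ⊥-elim (j≢i (sym i≡j))
... | no i≢j   | yes j≡i  = ⊥-elim (i≢j (sym j≡i))
irrefl (graphFrom f) i with i ≟ i
... | yes _   = refl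
... | no i≢i  = ⊥-elim (i≢i refl)

≅-graphFrom : ∀ {n} (G : Graph n) f → (∀ i j → adj G i j ≡ f i j) → G ≅ graphFrom f
≅-graphFrom G f G≡f = record { bij = ↔-refl ; preserve = preserve }
  where
    preserve : ∀ i j → adj G i j ≡ adj (graphFrom f) i j
    preserve i j with i ≟ j
    ... | yes refl = irrefl G i
    ... | no _ = begin
      adj G i j                ≡⟨ ∧-idem (adj G i j) ⟨
      adj G i j ∧ adj G i j    ≡⟨ cong (adj G i j ∧_) (adj-sym G i j) ⟩
      adj G i j ∧ adj G j i    ≡⟨ cong₂ _∧_ (G≡f i j) (G≡f j i) ⟩
      f i j ∧ f j i            ∎

graphsOfOrder : ∀ n → List (Graph n)
graphsOfOrder n = map (λ M → graphFrom (λ i j → lookup (lookup M i) j))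
                      (vectors (vectors (true ∷ false ∷ []) n) n)

graphsOfOrder-complete : ∀ {n} (G : Graph n) → Any (G ≅_) (graphsOfOrder n)
graphsOfOrder-complete {n} G =
  map⁺ (Any.map (λ { refl → ≅-graphFrom G _ lookup-matrix })
                (∈-vectors (∈-vectors ∈-bools) matrix))
  where
    matrix : Vec (Vec Bool n) n
    matrix = tabulate (λ i → tabulate (adj G i))

    lookup-matrix : ∀ i j → adj G i j ≡ lookup (lookup matrix i) j
    lookup-matrix i j = sym (begin
      lookup (lookup matrix i) j           ≡⟨ cong (λ row → lookup row j) (lookup∘tabulate _ i) ⟩
      lookup (tabulate (adj G i)) j        ≡⟨ lookup∘tabulate (adj G i) j ⟩
      adj G i j                            ∎)

graphsBelow : ℕ → List AnyGraph
graphsBelow zero    = []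
graphsBelow (suc b) = map (b ,_) (graphsOfOrder b) ++ graphsBelow b

graphsBelow-complete : ∀ b {n} (G : Graph n) → n < b → Any (λ P → G ≅ proj₂ P) (graphsBelow b)
graphsBelow-complete (suc b) {n} G (s≤s n≤b) with n ℕ.≟ b
... | yes refl = ++⁺ˡ (map⁺ (graphsOfOrder-complete G))
... | no n≢b   = ++⁺ʳ (map (b ,_) (graphsOfOrder b)) (graphsBelow-complete b G (≤∧≢⇒< n≤b n≢b))

totalOrder : List AnyGraph → ℕ
totalOrder = sum ∘ map proj₁

≅-member-≤-totalOrder : ∀ L {n} (G : Graph n) → Any (λ P → G ≅ proj₂ P) L → n ≤ totalOrder L
≅-member-≤-totalOrder ((m , _) ∷ L) G (here G≅H) = ≤-trans (≅⇒≤ G≅H) (m≤m+n m (totalOrder L))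
≅-member-≤-totalOrder ((m , _) ∷ L) G (there p)  =
  ≤-trans (≅-member-≤-totalOrder L G p) (m≤n+m (totalOrder L) m)

ForbidsCompleteAndEdgeless : GraphFun → Set
ForbidsCompleteAndEdgeless Φ =
  ∃[ s ] ∃[ t ] (1 ≤ s × 1 ≤ t × Φ (complete s) ≡ false × Φ (edgeless t) ≡ false)

constantTrue⇒meagre : ∀ {Φ : GraphFun} → ConstantTrue Φ → Meagre Φ
constantTrue⇒meagre true-everywhere = 0 , λ _ _ G H → trans (true-everywhere G) (sym (true-everywhere H))

constantTrue⇒Πempty : ∀ {Φ : GraphFun} → ConstantTrue Φ → ΠEmpty Φ
constantTrue⇒Πempty true-everywhere H (ΦH≡false , _) = not-¬ (true-everywhere H) ΦH≡false

Πempty⇒constantTrue : ∀ {Φ : GraphFun} → ΠEmpty Φ → ConstantTrue Φ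
Πempty⇒constantTrue {Φ} Π≡∅ {n} G = true-below (suc n) G ≤-refl
  where
    true-below : ∀ b {m} (H : Graph m) → m < b → Φ H ≡ true
    true-below (suc b) H (s≤s m≤b) = ¬-not λ ΦH≡false →
      Π≡∅ H (ΦH≡false , λ H' _ m'<m → true-below b H' (≤-trans m'<m m≤b))

finitelyMany⇒forbids : ∀ {Φ : GraphFun} → TrueForFinitelyMany Φ → ForbidsCompleteAndEdgeless Φ
finitelyMany⇒forbids {Φ} (L , ≅-member) =
  suc b , suc b , s≤s z≤n , s≤s z≤n , false-beyond (complete (suc b)) , false-beyond (edgeless (suc b))
  where
    b : ℕ
    b = totalOrder L

    false-beyond : (G : Graph (suc b)) → Φ G ≡ false
    false-beyond G = ¬-not λ ΦG≡true → 1+n≰n (≅-member-≤-totalOrder L G (≅-member G ΦG≡true))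

module _ {Φ : GraphFun} (hereditary : Hereditary Φ) where

  false-from-ramseyBound :
    ∀ {s t} → Φ (complete s) ≡ false → Φ (edgeless t) ≡ false →
    ∀ {n} (G : Graph n) → ramseyBound s t ≤ n → Φ G ≡ false
  false-from-ramseyBound {s} {t} ΦK≡false ΦI≡false G bound =
    Sum.[ (λ K↪G → hereditary-false hereditary K↪G ΦK≡false)
        , (λ I↪G → hereditary-false hereditary I↪G ΦI≡false) ] (Ramsey.ramsey-↪ G s t bound)

  forbids⇒meagre : ForbidsCompleteAndEdgeless Φ → Meagre Φ
  forbids⇒meagre (s , t , _ , _ , ΦK≡false , ΦI≡false) =
    ramseyBound s t , λ _ bound G H → trans (false-from G bound) (sym (false-from H bound))
    where
      false-from : ∀ {n} (G : Graph n) → ramseyBound s t ≤ n → Φ G ≡ false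
      false-from = false-from-ramseyBound ΦK≡false ΦI≡false

  forbids⇒finitelyMany : ForbidsCompleteAndEdgeless Φ → TrueForFinitelyMany Φ
  forbids⇒finitelyMany (s , t , _ , _ , ΦK≡false , ΦI≡false) =
    graphsBelow (ramseyBound s t) , λ G ΦG≡true →
      graphsBelow-complete (ramseyBound s t) G (≰⇒> λ bound →
        not-¬ ΦG≡true (false-from-ramseyBound ΦK≡false ΦI≡false G bound))

  meagre∧¬forbids⇒constantTrue : Meagre Φ → ¬ ForbidsCompleteAndEdgeless Φ → ConstantTrue Φ
  meagre∧¬forbids⇒constantTrue (N , constant) ¬forbids {m} G = ¬-not λ ΦG≡false →
    ¬forbids (k , k , s≤s z≤n , s≤s z≤n
             , false-at-k (complete k) ΦG≡false , false-at-k (edgeless k) ΦG≡false)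
    where
      k : ℕ
      k = suc (N + m)

      false-at-k : (H : Graph k) → Φ G ≡ false → Φ H ≡ false
      false-at-k H ΦG≡false =
        trans (constant k (≤-trans (m≤m+n N m) (n≤1+n (N + m))) H (addIsolatedVertices (suc N) G))
              (hereditary-false hereditary (↪-addIsolatedVertices (suc N) G) ΦG≡false)

mainTheorem6 : (Φ : GraphFun) → IsoInvariant Φ → Hereditary Φ →
    ((¬ Meagre Φ) ⇔ (TrueForInfinitelyMany Φ × ¬ ΠEmpty Φ))
    × ((TrueForInfinitelyMany Φ × ¬ ΠEmpty Φ) ⇔
       ((¬ ConstantTrue Φ) ×
        ¬ (∃[ s ] ∃[ t ] (1 ≤ s × 1 ≤ t × Φ (complete s) ≡ false × Φ (edgeless t) ≡ false))))
mainTheorem6 Φ _ hereditary = mk⇔ (3⇒2 ∘ 1⇒3) (3⇒1 ∘ 2⇒3) , mk⇔ 2⇒3 3⇒2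
  where
    Condition3 : Set
    Condition3 = ¬ ConstantTrue Φ × ¬ ForbidsCompleteAndEdgeless Φ

    1⇒3 : ¬ Meagre Φ → Condition3
    1⇒3 ¬meagre = ¬meagre ∘ constantTrue⇒meagre , ¬meagre ∘ forbids⇒meagre hereditary

    3⇒1 : Condition3 → ¬ Meagre Φ
    3⇒1 (¬constant , ¬forbids) meagre =
      ¬constant (meagre∧¬forbids⇒constantTrue hereditary meagre ¬forbids)

    2⇒3 : TrueForInfinitelyMany Φ × ¬ ΠEmpty Φ → Condition3
    2⇒3 (infinitelyMany , Π≢∅) =
      Π≢∅ ∘ constantTrue⇒Πempty , infinitelyMany ∘ forbids⇒finitelyMany hereditary

    3⇒2 : Condition3 → TrueForInfinitelyMany Φ × ¬ ΠEmpty Φ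
    3⇒2 (¬constant , ¬forbids) = ¬forbids ∘ finitelyMany⇒forbids , ¬constant ∘ Πempty⇒constantTrue
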